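{- For all positive integers $n,m$, the $(n\times m)$-Rook's graph $G$ satisfies $\mathrm{tww}(G)\le 2(m-1)$.
   Context: The $(n\times m)$-Rook's graph has vertex set $\{1,\dots,n\}\times\{1,\dots,m\}$, with distinct vertices $(i,j),(i',j')$ adjacent iff $i=i'$ or $j=j'$ (equivalently, it is the Cartesian product $K_n\square K_m$ of complete graphs). Twin-width: a trigraph is a vertex set with two disjoint sets of edges, black and red. Contracting two distinct vertices $u,v$ replaces them by a new vertex $w$; each $x\ne u,v$ adjacent to exactly one of $u,v$ is joined to $w$ by a red edge; each $x$ adjacent to both is joined to $w$ by a black edge if $ux,vx$ are both black and by a red edge otherwise; other edges are unchanged. A simple graph is a trigraph with no red edges. A $d$-sequence for an $N$-vertex graph $G$ is a sequence $G=G_N,\dots,G_1$ of trigraphs, each obtained from the previous by one contraction, with every vertex of every $G_i$ incident to at most $d$ red edges; $\mathrm{tww}(G)$ is the least such $d$. -}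

module Defs where

open import Data.Nat using (ℕ; zero; suc; _+_; _*_; _∸_; _≤_)
open import Data.Fin using (Fin; punchIn; remQuot; _≟_)
open import Data.Fin.Properties using ()
open import Data.Product using (_×_; _,_; proj₁; proj₂)
open import Data.List using (allFin; map)
open import Data.Nat.ListAction using (sum)
open import Data.Bool using (Bool; true; false; _∧_; _∨_; not)
open import Relation.Nullary.Decidable using (⌊_⌋)

data Colour : Set where
  none black red : Colour

-- A trigraph on the vertex set Fin k, given by the colour of each pair.
-- (Diagonal entries are always 'none'; all trigraphs arising here are symmetric.)
record Trigraph (k : ℕ) : Set where
  constructor trigraph
  field
    col : Fin k → Fin k → Colour
open Trigraph public

-- Colour of the edge wx after contracting u,v into w, given the colours of ux and vx.
merge : Colour → Colour → Colour
merge none  none  = none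
merge black black = black
merge _     _     = red

-- The vertex v is removed; the remaining vertices are identified with Fin k via
-- punchIn v, and the new vertex w occupies the slot of u' = punchIn v u (so u' ≠ v).
contract : {k : ℕ} → Trigraph (suc k) → (v : Fin (suc k)) → (u : Fin k) → Trigraph k
contract {k} T v u = trigraph c
  where
  u' = punchIn v u
  c : Fin k → Fin k → Colour
  c a b with ⌊ a ≟ u ⌋ | ⌊ b ≟ u ⌋
  ... | true  | true  = none
  ... | true  | false = merge (col T u' (punchIn v b)) (col T v (punchIn v b))
  ... | false | true  = merge (col T (punchIn v a) u') (col T (punchIn v a) v)
  ... | false | false = col T (punchIn v a) (punchIn v b)

isRed : Colour → ℕ
isRed red = 1
isRed _   = 0

redDeg : {k : ℕ} → Trigraph k → Fin k → ℕ
redDeg {k} T x = sum (map (λ y → isRed (col T x y)) (allFin k))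

RedBounded : ℕ → {k : ℕ} → Trigraph k → Set
RedBounded d {k} T = (x : Fin k) → redDeg T x ≤ d

data DSequence (d : ℕ) : (k : ℕ) → Trigraph k → Set where
  done : (T : Trigraph 1) → RedBounded d T → DSequence d 1 T
  step : {k : ℕ} (T : Trigraph (suc (suc k))) (v : Fin (suc (suc k))) (u : Fin (suc k)) →
         RedBounded d T → DSequence d (suc k) (contract T v u) → DSequence d (suc (suc k)) T

TwwAtMost : {N : ℕ} → Trigraph N → ℕ → Set
TwwAtMost {N} G d = DSequence d N G

rookAdj : {n m : ℕ} → Fin n × Fin m → Fin n × Fin m → Bool
rookAdj (i , j) (i' , j') =
  not (⌊ i ≟ i' ⌋ ∧ ⌊ j ≟ j' ⌋) ∧ (⌊ i ≟ i' ⌋ ∨ ⌊ j ≟ j' ⌋)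

toColour : Bool → Colour
toColour true  = black
toColour false = none

rook : (n m : ℕ) → Trigraph (n * m)
rook n m = trigraph (λ a b → toColour (rookAdj (remQuot {n} m a) (remQuot {n} m b)))

module Submission where

-- Number the cells of the board row by row, a = row a * m + column a, and contract the cells
-- of rows 1, …, n-1 in decreasing order, each into the top cell of its column.  At every
-- stage a vertex is either an untouched cell or the class of a column: its top cell together
-- with the already absorbed bottom part of the column.  A red edge joins either two classes,
-- or a class and a cell of the row currently being absorbed whose column differs from that
-- of the class; so every vertex sees at most m - 1 red edges of each kind.  When only the
-- m classes are left, any further contractions keep the red degree below m.

open import Algebra.Properties.CommutativeSemigroup using (interchange)
open import Data.Bool using (Bool; true; false; _∧_; _∨_; not; if_then_else_)
open import Data.Bool.Properties using (∨-comm; ∨-zeroʳ)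
open import Data.Fin as Fin using (Fin; toℕ; fromℕ; fromℕ<; punchIn; quotient; remainder; combine)
open import Data.Fin.Properties
  using (toℕ-injective; toℕ<n; toℕ-fromℕ; toℕ-fromℕ<; combine-remQuot; toℕ-combine)
open import Data.List using (tabulate; applyUpTo; allFin; [_]; _∷ʳ_)
open import Data.List.Properties using (map-tabulate; map-cong; applyUpTo-∷ʳ)
open import Data.Nat
  using (ℕ; zero; suc; _+_; _*_; _∸_; _⊓_; _≤_; _<_; z≤n; s≤s; s≤s⁻¹; _≤?_; _<?_; _≟_; _/_; _%_;
         NonZero; >-nonZero)
open import Data.Nat.DivMod
open import Data.Nat.ListAction using (sum)
open import Data.Nat.ListAction.Properties using (sum-++)
open import Data.Nat.Properties
open import Function using (_∘_; id)
open import Function.Bundles using (_⇔_; mk⇔)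
open import Relation.Binary.Definitions using (tri<; tri≈; tri>)
open import Relation.Binary.PropositionalEquality hiding ([_])
open import Relation.Nullary using (Dec; yes; no; ¬_; contradiction)
open import Relation.Nullary.Decidable using (⌊_⌋; isYes≗does; does-⇔; dec-true; dec-false)

open import Defs

⌊⌋-true : ∀ {a} {A : Set a} (a? : Dec A) → A → ⌊ a? ⌋ ≡ true
⌊⌋-true a? x = trans (isYes≗does a?) (dec-true a? x)

⌊⌋-false : ∀ {a} {A : Set a} (a? : Dec A) → ¬ A → ⌊ a? ⌋ ≡ false
⌊⌋-false a? ¬x = trans (isYes≗does a?) (dec-false a? ¬x)

⌊⌋-⇔ : ∀ {a b} {A : Set a} {B : Set b} → A ⇔ B → (a? : Dec A) (b? : Dec B) → ⌊ a? ⌋ ≡ ⌊ b? ⌋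
⌊⌋-⇔ A⇔B a? b? = trans (isYes≗does a?) (trans (does-⇔ A⇔B a? b?) (sym (isYes≗does b?)))

⌊≟⌋-sym : ∀ (x y : ℕ) → ⌊ x ≟ y ⌋ ≡ ⌊ y ≟ x ⌋
⌊≟⌋-sym x y = ⌊⌋-⇔ (mk⇔ sym sym) (x ≟ y) (y ≟ x)

⌊≟⌋-toℕ : ∀ {k} (x y : Fin k) → ⌊ x Fin.≟ y ⌋ ≡ ⌊ toℕ x ≟ toℕ y ⌋
⌊≟⌋-toℕ x y = ⌊⌋-⇔ (mk⇔ (cong toℕ) toℕ-injective) (x Fin.≟ y) (toℕ x ≟ toℕ y)

indicator : Bool → ℕ
indicator true  = 1
indicator false = 0

between : ℕ → ℕ → ℕ → ℕ
between a b y = indicator (⌊ a ≤? y ⌋ ∧ ⌊ y <? b ⌋)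

punctured : ℕ → ℕ → ℕ → ℕ
punctured b c y = between 0 c y + between (suc c) b y

between-≥1 : ∀ {a b y} → a ≤ y → y < b → 1 ≤ between a b y
between-≥1 {a} {b} {y} a≤y y<b with a ≤? y | y <? b
... | yes _  | yes _  = ≤-refl
... | no a≰y | _      = contradiction a≤y a≰y
... | yes _  | no y≮b = contradiction y<b y≮b

punctured-≥1 : ∀ {b c y} → y < b → y ≢ c → 1 ≤ punctured b c y
punctured-≥1 {b} {c} {y} y<b y≢c with <-cmp y c
... | tri< y<c _ _ = ≤-trans (between-≥1 z≤n y<c) (m≤m+n _ _)
... | tri≈ _ y≡c _ = contradiction y≡c y≢c
... | tri> _ _ c<y = ≤-trans (between-≥1 c<y y<b) (m≤n+m _ _)

sum-applyUpTo-suc : ∀ (f : ℕ → ℕ) N → sum (applyUpTo f (suc N)) ≡ sum (applyUpTo f N) + f N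
sum-applyUpTo-suc f N = begin
  sum (applyUpTo f (suc N))       ≡⟨ cong sum (applyUpTo-∷ʳ f N) ⟨
  sum (applyUpTo f N ∷ʳ f N)      ≡⟨ sum-++ (applyUpTo f N) [ f N ] ⟩
  sum (applyUpTo f N) + (f N + 0) ≡⟨ cong (sum (applyUpTo f N) +_) (+-identityʳ (f N)) ⟩
  sum (applyUpTo f N) + f N       ∎
  where open ≡-Reasoning

sum-applyUpTo-+ : ∀ (f g : ℕ → ℕ) N →
                  sum (applyUpTo (λ y → f y + g y) N) ≡ sum (applyUpTo f N) + sum (applyUpTo g N)
sum-applyUpTo-+ f g zero    = refl
sum-applyUpTo-+ f g (suc N) =
  trans (cong (f 0 + g 0 +_) (sum-applyUpTo-+ (f ∘ suc) (g ∘ suc) N))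
        (interchange +-commutativeSemigroup (f 0) (g 0) _ _)

sum-tabulate-≤ : ∀ {N} (h : Fin N → ℕ) (g : ℕ → ℕ) → (∀ i → h i ≤ g (toℕ i)) →
                 sum (tabulate h) ≤ sum (applyUpTo g N)
sum-tabulate-≤ {zero}  h g h≤g = z≤n
sum-tabulate-≤ {suc N} h g h≤g =
  +-mono-≤ (h≤g Fin.zero) (sum-tabulate-≤ (h ∘ Fin.suc) (g ∘ suc) (h≤g ∘ Fin.suc))

sum-between≤ : ∀ a b N → sum (applyUpTo (between a b) N) ≤ b ∸ a
sum-between≤ a b N = ≤-trans (sum≤ N) (∸-monoˡ-≤ a (m⊓n≤n N b))
  where
  open ≤-Reasoning
  sum≤ : ∀ N → sum (applyUpTo (between a b) N) ≤ N ⊓ b ∸ a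
  sum+0≤ : ∀ N → sum (applyUpTo (between a b) N) + 0 ≤ suc N ⊓ b ∸ a

  sum≤ zero    = z≤n
  sum≤ (suc N) rewrite sum-applyUpTo-suc (between a b) N with a ≤? N | N <? b
  ... | yes a≤N | yes N<b = begin
    sum (applyUpTo (between a b) N) + 1 ≤⟨ +-monoˡ-≤ 1 (sum≤ N) ⟩
    N ⊓ b ∸ a + 1                       ≡⟨ cong (λ k → k ∸ a + 1) (m≤n⇒m⊓n≡m (<⇒≤ N<b)) ⟩
    N ∸ a + 1                           ≡⟨ +-∸-comm 1 a≤N ⟨
    N + 1 ∸ a                           ≡⟨ cong (_∸ a) (+-comm N 1) ⟩
    suc N ∸ a                           ≡⟨ cong (_∸ a) (m≤n⇒m⊓n≡m N<b) ⟨
    suc N ⊓ b ∸ a                       ∎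
  ... | yes _ | no _ = sum+0≤ N
  ... | no _  | _    = sum+0≤ N

  sum+0≤ N = begin
    sum (applyUpTo (between a b) N) + 0 ≡⟨ +-identityʳ _ ⟩
    sum (applyUpTo (between a b) N)     ≤⟨ sum≤ N ⟩
    N ⊓ b ∸ a                           ≤⟨ ∸-monoˡ-≤ a (⊓-monoˡ-≤ b (n≤1+n N)) ⟩
    suc N ⊓ b ∸ a                       ∎

sum-punctured≤ : ∀ {b c} N → c < b → sum (applyUpTo (punctured b c) N) ≤ b ∸ 1
sum-punctured≤ {suc b} {c} N (s≤s c≤b) = begin
  sum (applyUpTo (punctured (suc b) c) N)
    ≡⟨ sum-applyUpTo-+ (between 0 c) (between (suc c) (suc b)) N ⟩
  sum (applyUpTo (between 0 c) N) + sum (applyUpTo (between (suc c) (suc b)) N)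
    ≤⟨ +-mono-≤ (sum-between≤ 0 c N) (sum-between≤ (suc c) (suc b) N) ⟩
  c + (b ∸ c)
    ≡⟨ m+[n∸m]≡n c≤b ⟩
  b ∎
  where open ≤-Reasoning

module _ {m : ℕ} .{{_ : NonZero m}} where

  /m*m+%m : ∀ a → a / m * m + a % m ≡ a
  /m*m+%m a = trans (+-comm (a / m * m) (a % m)) (sym (m≡m%n+[m/n]*n a m))

  [q*m+j]%m≡j : ∀ q {j} → j < m → (q * m + j) % m ≡ j
  [q*m+j]%m≡j q {j} j<m = begin
    (q * m + j) % m ≡⟨ cong (_% m) (+-comm (q * m) j) ⟩
    (j + q * m) % m ≡⟨ [m+kn]%n≡m%n j q m ⟩
    j % m           ≡⟨ m<n⇒m%n≡m j<m ⟩
    j               ∎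
    where open ≡-Reasoning

  [q*m+j]/m≡q : ∀ q {j} → j < m → (q * m + j) / m ≡ q
  [q*m+j]/m≡q q {j} j<m = begin
    (q * m + j) / m   ≡⟨ +-distrib-/ (q * m) j no-carry ⟩
    q * m / m + j / m ≡⟨ cong₂ _+_ (m*n/n≡m q m) (m<n⇒m/n≡0 j<m) ⟩
    q + 0             ≡⟨ +-identityʳ q ⟩
    q                 ∎
    where
    open ≡-Reasoning
    no-carry : (q * m) % m + j % m < m
    no-carry = subst (_< m) (sym (cong₂ _+_ (m*n%n≡0 q m) (m<n⇒m%n≡m j<m))) j<m

  q*m+j<[1+q]*m : ∀ q {j} → j < m → q * m + j < suc q * m
  q*m+j<[1+q]*m q {j} j<m = <-≤-trans (+-monoʳ-< (q * m) j<m) (≤-reflexive (+-comm (q * m) m))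

  q*m+j<n*m : ∀ {n q j} → q < n → j < m → q * m + j < n * m
  q*m+j<n*m {n} {q} q<n j<m = <-≤-trans (q*m+j<[1+q]*m q j<m) (*-monoˡ-≤ m q<n)

  ≤q*m+j⇒/m≤q : ∀ {N} q {j} → j < m → N ≤ q * m + j → N / m ≤ q
  ≤q*m+j⇒/m≤q {N} q j<m N≤ = s≤s⁻¹ (m<n*o⇒m/o<n (≤-<-trans N≤ (q*m+j<[1+q]*m q j<m)))

  toℕ-remQuot : ∀ {n} (a : Fin (n * m)) → toℕ a ≡ toℕ (quotient {n} m a) * m + toℕ (remainder {n} m a)
  toℕ-remQuot {n} a = begin
    toℕ a             ≡⟨ cong toℕ (combine-remQuot {n} m a) ⟨
    toℕ (combine q r) ≡⟨ toℕ-combine q r ⟩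
    m * toℕ q + toℕ r ≡⟨ cong (_+ toℕ r) (*-comm m (toℕ q)) ⟩
    toℕ q * m + toℕ r ∎
    where
    open ≡-Reasoning
    q = quotient {n} m a
    r = remainder {n} m a

  toℕ-quotient : ∀ {n} (a : Fin (n * m)) → toℕ (quotient {n} m a) ≡ toℕ a / m
  toℕ-quotient {n} a =
    sym (trans (cong (_/ m) (toℕ-remQuot {n} a))
               ([q*m+j]/m≡q (toℕ (quotient {n} m a)) (toℕ<n (remainder {n} m a))))

  toℕ-remainder : ∀ {n} (a : Fin (n * m)) → toℕ (remainder {n} m a) ≡ toℕ a % m
  toℕ-remainder {n} a =
    sym (trans (cong (_% m) (toℕ-remQuot {n} a))
               ([q*m+j]%m≡j (toℕ (quotient {n} m a)) (toℕ<n (remainder {n} m a))))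

toℕ-punchIn-fromℕ : ∀ {N} (a : Fin N) → toℕ (punchIn (fromℕ N) a) ≡ toℕ a
toℕ-punchIn-fromℕ Fin.zero    = refl
toℕ-punchIn-fromℕ (Fin.suc a) = cong suc (toℕ-punchIn-fromℕ a)

isRed≤1 : ∀ c → isRed c ≤ 1
isRed≤1 none  = z≤n
isRed≤1 black = z≤n
isRed≤1 red   = ≤-refl

isRed-toColour : ∀ s → isRed (toColour s) ≡ 0
isRed-toColour true  = refl
isRed-toColour false = refl

if-black-none : ∀ s → (if s then black else none) ≡ toColour s
if-black-none true  = refl
if-black-none false = refl

merge-red : ∀ s t → merge (if s then red else black) (if t then red else none) ≡ red
merge-red true  true  = refl
merge-red true  false = refl
merge-red false true  = refl
merge-red false false = refl

_≐_ : ∀ {k} → Trigraph k → Trigraph k → Set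
S ≐ T = ∀ a b → col S a b ≡ col T a b

contract-cong : ∀ {k} {S T : Trigraph (suc k)} v u → S ≐ T → contract S v u ≐ contract T v u
contract-cong v u S≐T a b with ⌊ a Fin.≟ u ⌋ | ⌊ b Fin.≟ u ⌋
... | true  | true  = refl
... | true  | false = cong₂ merge (S≐T _ _) (S≐T _ _)
... | false | true  = cong₂ merge (S≐T _ _) (S≐T _ _)
... | false | false = S≐T _ _

redDeg-cong : ∀ {k} {S T : Trigraph k} → S ≐ T → ∀ x → redDeg S x ≡ redDeg T x
redDeg-cong {k} S≐T x = cong sum (map-cong (λ y → cong isRed (S≐T x y)) (allFin k))

RedBounded-cong : ∀ {d k} {S T : Trigraph k} → S ≐ T → RedBounded d S → RedBounded d T
RedBounded-cong {d} S≐T bounded x = subst (_≤ d) (redDeg-cong S≐T x) (bounded x)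

DSequence-cong : ∀ {d k} {S T : Trigraph k} → S ≐ T → DSequence d k S → DSequence d k T
DSequence-cong S≐T (done _ bounded) = done _ (RedBounded-cong S≐T bounded)
DSequence-cong S≐T (step _ v u bounded seq) =
  step _ v u (RedBounded-cong S≐T bounded) (DSequence-cong (contract-cong v u S≐T) seq)

redDeg-≤-sum : ∀ {k} (T : Trigraph k) x (g : ℕ → ℕ) → (∀ y → isRed (col T x y) ≤ g (toℕ y)) →
               redDeg T x ≤ sum (applyUpTo g k)
redDeg-≤-sum {k} T x g bound =
  subst (_≤ sum (applyUpTo g k)) (cong sum (sym (map-tabulate {n = k} id (λ y → isRed (col T x y)))))
    (sum-tabulate-≤ _ g bound)

Loopless : ∀ {k} → Trigraph k → Set
Loopless {k} T = ∀ (x : Fin k) → col T x x ≡ none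

contract-loopless : ∀ {k} (T : Trigraph (suc k)) v u → Loopless T → Loopless (contract T v u)
contract-loopless T v u loopless x with ⌊ x Fin.≟ u ⌋
... | true  = refl
... | false = loopless _

loopless-RedBounded : ∀ {k} (T : Trigraph (suc k)) → Loopless T → RedBounded k T
loopless-RedBounded {k} T loopless x =
  ≤-trans (redDeg-≤-sum T x (punctured (suc k) (toℕ x)) bound) (sum-punctured≤ (suc k) (toℕ<n x))
  where
  bound : ∀ y → isRed (col T x y) ≤ punctured (suc k) (toℕ x) (toℕ y)
  bound y with x Fin.≟ y
  ... | yes refl = subst (λ c → isRed c ≤ _) (sym (loopless x)) z≤n
  ... | no x≢y   = ≤-trans (isRed≤1 _) (punctured-≥1 (toℕ<n y) (x≢y ∘ sym ∘ toℕ-injective))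

loopless-DSequence : ∀ {d k} (T : Trigraph (suc k)) → Loopless T → k ≤ d → DSequence d (suc k) T
loopless-DSequence {k = zero} T loopless _ =
  done T (λ x → ≤-trans (loopless-RedBounded T loopless x) z≤n)
loopless-DSequence {k = suc k} T loopless k≤d =
  step T Fin.zero Fin.zero (λ x → ≤-trans (loopless-RedBounded T loopless x) k≤d)
    (loopless-DSequence (contract T Fin.zero Fin.zero) (contract-loopless T Fin.zero Fin.zero loopless)
      (≤-trans (n≤1+n k) k≤d))

-- In stage N the vertices 0, …, N-1 are the untouched cells a ≥ m and, for j < m, the class
-- of column j, made of the cell j and the cells q * m + j ≥ N (those already contracted into it).
module Rook (n m′ : ℕ) where

  m : ℕ
  m = suc m′

  row column : ℕ → ℕ
  row a = a / m
  column a = a % m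

  absorbed : ℕ → ℕ → ℕ → Bool
  absorbed N q j = ⌊ N ≤? q * m + j ⌋

  -- Cells are absorbed from the last row upwards, so a class is still a single cell
  -- exactly when its cell in the last row is not absorbed.
  classColour : ℕ → ℕ → ℕ → Colour
  classColour N i j = if absorbed N (n ∸ 1) i ∨ absorbed N (n ∸ 1) j then red else black

  classCellColour : ℕ → ℕ → ℕ → Colour
  classCellColour N j b = if ⌊ j ≟ column b ⌋ then black else if absorbed N (row b) j then red else none

  cellColour : ℕ → ℕ → Colour
  cellColour a b = toColour (⌊ row a ≟ row b ⌋ ∨ ⌊ column a ≟ column b ⌋)

  stageColour : ℕ → ℕ → ℕ → Colour
  stageColour N a b with a ≟ b | a <? m | b <? m
  ... | yes _ | _     | _     = none
  ... | no _  | yes _ | yes _ = classColour N a b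
  ... | no _  | yes _ | no _  = classCellColour N a b
  ... | no _  | no _  | yes _ = classCellColour N b a
  ... | no _  | no _  | no _  = cellColour a b

  stage : (N : ℕ) → Trigraph N
  stage N = trigraph (λ a b → stageColour N (toℕ a) (toℕ b))

  absorbed-true : ∀ {N q j} → N ≤ q * m + j → absorbed N q j ≡ true
  absorbed-true {N} {q} {j} = ⌊⌋-true (N ≤? q * m + j)

  absorbed-false : ∀ {N q j} → q * m + j < N → absorbed N q j ≡ false
  absorbed-false {N} {q} {j} <N = ⌊⌋-false (N ≤? q * m + j) (<⇒≱ <N)

  absorbed-suc : ∀ N q {j} → j < m → j ≢ column N → absorbed (suc N) q j ≡ absorbed N q j
  absorbed-suc N q {j} j<m j≢column-N with suc N ≤? q * m + j | N ≤? q * m + j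
  ... | yes _    | yes _  = refl
  ... | no _     | no _   = refl
  ... | yes 1+N≤ | no N≰  = contradiction (≤-trans (n≤1+n N) 1+N≤) N≰
  ... | no 1+N≰  | yes N≤ = contradiction (sym (trans (cong column N≡) ([q*m+j]%m≡j q j<m))) j≢column-N
    where
    N≡ : N ≡ q * m + j
    N≡ = ≤-antisym N≤ (≮⇒≥ 1+N≰)

  classCellColour-≢ : ∀ N {j b} → j ≢ column b →
                      classCellColour N j b ≡ (if absorbed N (row b) j then red else none)
  classCellColour-≢ N {j} {b} j≢ with j ≟ column b
  ... | yes j≡ = contradiction j≡ j≢
  ... | no _   = refl

  cellColour-sym : ∀ a b → cellColour a b ≡ cellColour b a
  cellColour-sym a b = cong toColour (cong₂ _∨_ (⌊≟⌋-sym (row a) (row b)) (⌊≟⌋-sym (column a) (column b)))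

  stageColour-refl : ∀ N a → stageColour N a a ≡ none
  stageColour-refl N a with a ≟ a
  ... | yes _   = refl
  ... | no a≢a = contradiction refl a≢a

  stageColour-sym : ∀ N a b → stageColour N a b ≡ stageColour N b a
  stageColour-sym N a b with a ≟ b | b ≟ a | a <? m | b <? m
  ... | yes _   | yes _   | _     | _     = refl
  ... | yes a≡b | no b≢a  | _     | _     = contradiction (sym a≡b) b≢a
  ... | no a≢b  | yes b≡a | _     | _     = contradiction (sym b≡a) a≢b
  ... | no _    | no _    | yes _ | yes _ =
    cong (λ s → if s then red else black) (∨-comm (absorbed N (n ∸ 1) a) (absorbed N (n ∸ 1) b))
  ... | no _    | no _    | yes _ | no _  = refl
  ... | no _    | no _    | no _  | yes _ = refl
  ... | no _    | no _    | no _  | no _  = cellColour-sym a b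

  stageColour-classes : ∀ N {i j} → i ≢ j → i < m → j < m → stageColour N i j ≡ classColour N i j
  stageColour-classes N {i} {j} i≢j i<m j<m with i ≟ j | i <? m | j <? m
  ... | yes i≡j | _      | _      = contradiction i≡j i≢j
  ... | no _    | yes _  | yes _  = refl
  ... | no _    | no i≮m | _      = contradiction i<m i≮m
  ... | no _    | yes _  | no j≮m = contradiction j<m j≮m

  stageColour-class-cell : ∀ N {j b} → j < m → m ≤ b → stageColour N j b ≡ classCellColour N j b
  stageColour-class-cell N {j} {b} j<m m≤b with j ≟ b | j <? m | b <? m
  ... | yes refl | _      | _       = contradiction j<m (≤⇒≯ m≤b)
  ... | no _     | yes _  | no _    = refl
  ... | no _     | no j≮m | _       = contradiction j<m j≮m
  ... | no _     | yes _  | yes b<m = contradiction b<m (≤⇒≯ m≤b)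

  stageColour-cell-class : ∀ N {a j} → m ≤ a → j < m → stageColour N a j ≡ classCellColour N j a
  stageColour-cell-class N {a} {j} m≤a j<m =
    trans (stageColour-sym N a j) (stageColour-class-cell N j<m m≤a)

  stageColour-cells : ∀ N {a b} → a ≢ b → m ≤ a → m ≤ b → stageColour N a b ≡ cellColour a b
  stageColour-cells N {a} {b} a≢b m≤a m≤b with a ≟ b | a <? m | b <? m
  ... | yes a≡b | _       | _       = contradiction a≡b a≢b
  ... | no _    | no _    | no _    = refl
  ... | no _    | yes a<m | _       = contradiction a<m (≤⇒≯ m≤a)
  ... | no _    | no _    | yes b<m = contradiction b<m (≤⇒≯ m≤b)

  isRed-classCellColour≤between : ∀ N {j b} → j < m → b < N →
                                  isRed (classCellColour N j b) ≤ between (row N * m) N b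
  isRed-classCellColour≤between N {j} {b} j<m b<N with j ≟ column b | N ≤? row b * m + j
  ... | yes _ | _        = z≤n
  ... | no _  | no _     = z≤n
  ... | no _  | yes N≤bj = between-≥1 (begin
    row N * m ≤⟨ *-monoˡ-≤ m (≤q*m+j⇒/m≤q (row b) j<m N≤bj) ⟩
    row b * m ≤⟨ m/n*n≤m b m ⟩
    b         ∎) b<N
    where open ≤-Reasoning

  isRed-classCellColour≤punctured : ∀ N {j} b → j < m →
                                    isRed (classCellColour N j b) ≤ punctured m (column b) j
  isRed-classCellColour≤punctured N {j} b j<m with j ≟ column b
  ... | yes _ = z≤n
  ... | no j≢ = ≤-trans (isRed≤1 _) (punctured-≥1 j<m j≢)

  redCandidate : ℕ → ℕ → ℕ → ℕ
  redCandidate N x y = punctured m (column x) y + between (row N * m) N y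

  isRed-stageColour≤-≢ : ∀ N {x y} → x ≢ y → y < N → isRed (stageColour N x y) ≤ redCandidate N x y
  isRed-stageColour≤-≢ N {x} {y} x≢y y<N with m ≤? x | m ≤? y
  ... | no x≱m  | no y≱m  =
    ≤-trans (≤-reflexive (cong isRed (stageColour-classes N x≢y (≰⇒> x≱m) (≰⇒> y≱m))))
      (≤-trans (isRed≤1 _) (≤-trans (punctured-≥1 (≰⇒> y≱m) y≢column-x) (m≤m+n _ _)))
    where
    y≢column-x : y ≢ column x
    y≢column-x y≡ = x≢y (sym (trans y≡ (m<n⇒m%n≡m (≰⇒> x≱m))))
  ... | no x≱m  | yes m≤y =
    ≤-trans (≤-reflexive (cong isRed (stageColour-class-cell N (≰⇒> x≱m) m≤y)))
      (≤-trans (isRed-classCellColour≤between N (≰⇒> x≱m) y<N) (m≤n+m _ _))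
  ... | yes m≤x | no y≱m  =
    ≤-trans (≤-reflexive (cong isRed (stageColour-cell-class N m≤x (≰⇒> y≱m))))
      (≤-trans (isRed-classCellColour≤punctured N x (≰⇒> y≱m)) (m≤m+n _ _))
  ... | yes m≤x | yes m≤y =
    ≤-trans (≤-reflexive (trans (cong isRed (stageColour-cells N x≢y m≤x m≤y)) (isRed-toColour _))) z≤n

  -- Splitting on x ≟ y (or x <? m) here would also abstract it inside stageColour N x y.
  isRed-stageColour≤ : ∀ N x {y} → y < N → isRed (stageColour N x y) ≤ redCandidate N x y
  isRed-stageColour≤ N x {y} y<N with <-cmp x y
  ... | tri< _ x≢y _  = isRed-stageColour≤-≢ N x≢y y<N
  ... | tri≈ _ refl _ = ≤-trans (≤-reflexive (cong isRed (stageColour-refl N x))) z≤n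
  ... | tri> _ x≢y _  = isRed-stageColour≤-≢ N x≢y y<N

  stage-RedBounded : ∀ N → RedBounded (2 * m′) (stage N)
  stage-RedBounded N x = begin
    redDeg (stage N) x
      ≤⟨ redDeg-≤-sum (stage N) x (redCandidate N (toℕ x)) (λ y → isRed-stageColour≤ N (toℕ x) (toℕ<n y)) ⟩
    sum (applyUpTo (redCandidate N (toℕ x)) N)
      ≡⟨ sum-applyUpTo-+ (punctured m (column (toℕ x))) (between (row N * m) N) N ⟩
    sum (applyUpTo (punctured m (column (toℕ x))) N) + sum (applyUpTo (between (row N * m) N) N)
      ≤⟨ +-mono-≤ (sum-punctured≤ N (m%n<n (toℕ x) m)) (sum-between≤ (row N * m) N N) ⟩
    m′ + (N ∸ row N * m)
      ≡⟨ cong (m′ +_) (m%n≡m∸m/n*n N m) ⟨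
    m′ + column N
      ≤⟨ +-monoʳ-≤ m′ (s≤s⁻¹ (m%n<n N m)) ⟩
    m′ + m′
      ≡⟨ cong (m′ +_) (+-identityʳ m′) ⟨
    2 * m′ ∎
    where open ≤-Reasoning

  stageColour-suc : ∀ N {a b} → a ≢ column N → b ≢ column N → stageColour (suc N) a b ≡ stageColour N a b
  stageColour-suc N {a} {b} a≢ b≢ with a ≟ b | a <? m | b <? m
  ... | yes _ | _       | _       = refl
  ... | no _  | yes a<m | yes b<m =
    cong₂ (λ s t → if s ∨ t then red else black) (absorbed-suc N (n ∸ 1) a<m a≢) (absorbed-suc N (n ∸ 1) b<m b≢)
  ... | no _  | yes a<m | no _    =
    cong (λ s → if ⌊ a ≟ column b ⌋ then black else if s then red else none) (absorbed-suc N (row b) a<m a≢)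
  ... | no _  | no _    | yes b<m =
    cong (λ s → if ⌊ b ≟ column a ⌋ then black else if s then red else none) (absorbed-suc N (row a) b<m b≢)
  ... | no _  | no _    | no _    = refl

  module Contraction (N : ℕ) (m≤N : m ≤ N) (N<n*m : N < n * m) where

    j : ℕ
    j = column N

    j<m : j < m
    j<m = m%n<n N m

    lastRow-absorbed : absorbed N (n ∸ 1) j ≡ true
    lastRow-absorbed = absorbed-true {q = n ∸ 1} (begin
      N               ≡⟨ /m*m+%m N ⟨
      row N * m + j   ≤⟨ +-monoˡ-≤ j (*-monoˡ-≤ m row-N≤n∸1) ⟩
      (n ∸ 1) * m + j ∎)
      where
      open ≤-Reasoning
      row-N≤n∸1 : row N ≤ n ∸ 1
      row-N≤n∸1 = subst (row N ≤_) (pred[m∸n]≡m∸[1+n] n 0) (<⇒≤pred (m<n*o⇒m/o<n {n = n} N<n*m))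

    cell-in-row-N : ∀ {b} → row N ≡ row b → row b * m + j ≡ N
    cell-in-row-N {b} same-row = trans (cong (λ r → r * m + j) (sym same-row)) (/m*m+%m N)

    cell-above-N : ∀ {b} → b < N → row N ≢ row b → row b * m + j < N
    cell-above-N {b} b<N other-row = begin-strict
      row b * m + j   <⟨ q*m+j<[1+q]*m (row b) j<m ⟩
      suc (row b) * m ≤⟨ *-monoˡ-≤ m (≤∧≢⇒< (/-monoˡ-≤ m (<⇒≤ b<N)) (other-row ∘ sym)) ⟩
      row N * m       ≤⟨ m/n*n≤m N m ⟩
      N               ∎
      where open ≤-Reasoning

    merged-class-class : ∀ {b} → b < m → b ≢ j →
                         merge (stageColour (suc N) j b) (stageColour (suc N) N b) ≡ stageColour N j b
    merged-class-class {b} b<m b≢j = begin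
      merge (stageColour (suc N) j b) (stageColour (suc N) N b)
        ≡⟨ cong₂ merge (stageColour-classes (suc N) (b≢j ∘ sym) j<m b<m)
             (trans (stageColour-cell-class (suc N) m≤N b<m) (classCellColour-≢ (suc N) {b = N} b≢j)) ⟩
      merge (classColour (suc N) j b) (if absorbed (suc N) (row N) b then red else none)
        ≡⟨ merge-red _ _ ⟩
      red
        ≡⟨ cong (λ s → if s ∨ absorbed N (n ∸ 1) b then red else black) lastRow-absorbed ⟨
      classColour N j b
        ≡⟨ stageColour-classes N (b≢j ∘ sym) j<m b<m ⟨
      stageColour N j b ∎
      where open ≡-Reasoning

    merged-class-cell : ∀ {b} → m ≤ b → b < N →
                        merge (stageColour (suc N) j b) (stageColour (suc N) N b) ≡ stageColour N j b
    merged-class-cell {b} m≤b b<N = begin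
      merge (stageColour (suc N) j b) (stageColour (suc N) N b)
        ≡⟨ cong₂ merge (stageColour-class-cell (suc N) j<m m≤b) (stageColour-cells (suc N) (>⇒≢ b<N) m≤N m≤b) ⟩
      merge (classCellColour (suc N) j b) (cellColour N b)
        ≡⟨ merge-classCellColour-cellColour ⟩
      classCellColour N j b
        ≡⟨ stageColour-class-cell N j<m m≤b ⟨
      stageColour N j b ∎
      where
      open ≡-Reasoning
      merge-classCellColour-cellColour : merge (classCellColour (suc N) j b) (cellColour N b) ≡ classCellColour N j b
      merge-classCellColour-cellColour with j ≟ column b
      ... | yes _ rewrite ∨-zeroʳ ⌊ row N ≟ row b ⌋ = refl
      ... | no _ with row N ≟ row b
      ...   | yes same-row
        rewrite absorbed-false {suc N} {row b} {j} (s≤s (≤-reflexive (cell-in-row-N {b} same-row)))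
              | absorbed-true {N} {row b} {j} (≤-reflexive (sym (cell-in-row-N {b} same-row))) = refl
      ...   | no other-row
        rewrite absorbed-false {suc N} {row b} {j} (m<n⇒m<1+n (cell-above-N b<N other-row))
              | absorbed-false {N} {row b} {j} (cell-above-N b<N other-row) = refl

    mergedˡ : ∀ {b} → b < N → b ≢ j →
              merge (stageColour (suc N) j b) (stageColour (suc N) N b) ≡ stageColour N j b
    mergedˡ {b} b<N b≢j with m ≤? b
    ... | yes m≤b = merged-class-cell m≤b b<N
    ... | no b≱m  = merged-class-class (≰⇒> b≱m) b≢j

    mergedʳ : ∀ {a} → a < N → a ≢ j →
              merge (stageColour (suc N) a j) (stageColour (suc N) a N) ≡ stageColour N a j
    mergedʳ {a} a<N a≢j = begin
      merge (stageColour (suc N) a j) (stageColour (suc N) a N)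
        ≡⟨ cong₂ merge (stageColour-sym (suc N) a j) (stageColour-sym (suc N) a N) ⟩
      merge (stageColour (suc N) j a) (stageColour (suc N) N a)
        ≡⟨ mergedˡ a<N a≢j ⟩
      stageColour N j a
        ≡⟨ stageColour-sym N j a ⟩
      stageColour N a j ∎
      where open ≡-Reasoning

    u : Fin N
    u = fromℕ< (<-≤-trans j<m m≤N)

    toℕ-u : toℕ u ≡ j
    toℕ-u = toℕ-fromℕ< (<-≤-trans j<m m≤N)

    toℕ-≢-j : ∀ {a} → a ≢ u → toℕ a ≢ j
    toℕ-≢-j a≢u toℕ-a≡j = a≢u (toℕ-injective (trans toℕ-a≡j (sym toℕ-u)))

    contract-stage : contract (stage (suc N)) (fromℕ N) u ≐ stage N
    contract-stage a b with a Fin.≟ u | b Fin.≟ u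
    ... | yes refl | yes refl = sym (stageColour-refl N (toℕ u))
    ... | yes refl | no b≢u
      rewrite toℕ-punchIn-fromℕ u | toℕ-punchIn-fromℕ b | toℕ-fromℕ N | toℕ-u =
        mergedˡ (toℕ<n b) (toℕ-≢-j b≢u)
    ... | no a≢u   | yes refl
      rewrite toℕ-punchIn-fromℕ u | toℕ-punchIn-fromℕ a | toℕ-fromℕ N | toℕ-u =
        mergedʳ (toℕ<n a) (toℕ-≢-j a≢u)
    ... | no a≢u   | no b≢u
      rewrite toℕ-punchIn-fromℕ a | toℕ-punchIn-fromℕ b =
        stageColour-suc N (toℕ-≢-j a≢u) (toℕ-≢-j b≢u)

  stage-DSequence : ∀ N → m ≤ N → N ≤ n * m → DSequence (2 * m′) N (stage N)
  stage-DSequence (suc N) m≤1+N 1+N≤nm with m ≤? N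
  ... | no N≱m = loopless-DSequence (stage (suc N)) (λ x → stageColour-refl (suc N) (toℕ x))
                   (≤-trans (s≤s⁻¹ (≰⇒> N≱m)) (m≤m+n m′ (m′ + 0)))
  stage-DSequence (suc (suc N)) _ 2+N≤nm | yes m≤1+N =
    step (stage (suc (suc N))) (fromℕ (suc N)) (Contraction.u (suc N) m≤1+N 2+N≤nm) (stage-RedBounded _)
      (DSequence-cong (λ a b → sym (Contraction.contract-stage (suc N) m≤1+N 2+N≤nm a b))
        (stage-DSequence (suc N) m≤1+N (<⇒≤ 2+N≤nm)))

  rookColour : ℕ → ℕ → Colour
  rookColour a b =
    toColour (not (⌊ row a ≟ row b ⌋ ∧ ⌊ column a ≟ column b ⌋) ∧ (⌊ row a ≟ row b ⌋ ∨ ⌊ column a ≟ column b ⌋))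

  rook≐rookColour : ∀ a b → col (rook n m) a b ≡ rookColour (toℕ a) (toℕ b)
  rook≐rookColour a b = cong₂ (λ s t → toColour (not (s ∧ t) ∧ (s ∨ t)))
    (trans (⌊≟⌋-toℕ _ _) (cong₂ (λ x y → ⌊ x ≟ y ⌋) (toℕ-quotient {n = n} a) (toℕ-quotient {n = n} b)))
    (trans (⌊≟⌋-toℕ _ _) (cong₂ (λ x y → ⌊ x ≟ y ⌋) (toℕ-remainder {n = n} a) (toℕ-remainder {n = n} b)))

  rookColour-refl : ∀ a → rookColour a a ≡ none
  rookColour-refl a with row a ≟ row a | column a ≟ column a
  ... | yes _  | yes _  = refl
  ... | no r≢r | _      = contradiction refl r≢r
  ... | yes _  | no c≢c = contradiction refl c≢c

  rookColour-≢ : ∀ {a b} → a ≢ b → rookColour a b ≡ cellColour a b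
  rookColour-≢ {a} {b} a≢b with row a ≟ row b | column a ≟ column b
  ... | yes same-row | yes same-column =
    contradiction (trans (sym (/m*m+%m a)) (trans (cong₂ (λ r c → r * m + c) same-row same-column) (/m*m+%m b)))
                  a≢b
  ... | yes _ | no _  = refl
  ... | no _  | yes _ = refl
  ... | no _  | no _  = refl

  module Initial (1≤n : 1 ≤ n) where

    absorbed-initial : ∀ {q j} → q < n → j < m → absorbed (n * m) q j ≡ false
    absorbed-initial {q} {j} q<n j<m = absorbed-false {q = q} {j = j} (q*m+j<n*m q<n j<m)

    n∸1<n : n ∸ 1 < n
    n∸1<n = ∸-monoʳ-< {o = 0} ≤-refl 1≤n

    stageColour-initial-classes : ∀ {a b} → a ≢ b → a < m → b < m → stageColour (n * m) a b ≡ cellColour a b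
    stageColour-initial-classes {a} {b} a≢b a<m b<m = begin
      stageColour (n * m) a b
        ≡⟨ stageColour-classes (n * m) a≢b a<m b<m ⟩
      classColour (n * m) a b
        ≡⟨ cong₂ (λ s t → if s ∨ t then red else black) (absorbed-initial n∸1<n a<m) (absorbed-initial n∸1<n b<m) ⟩
      black
        ≡⟨ cong (λ s → toColour (s ∨ ⌊ column a ≟ column b ⌋)) (⌊⌋-true (row a ≟ row b) same-row) ⟨
      cellColour a b ∎
      where
      open ≡-Reasoning
      same-row : row a ≡ row b
      same-row = trans (m<n⇒m/n≡0 a<m) (sym (m<n⇒m/n≡0 b<m))

    stageColour-initial-class-cell : ∀ {a b} → a < m → m ≤ b → b < n * m →
                                     stageColour (n * m) a b ≡ cellColour a b
    stageColour-initial-class-cell {a} {b} a<m m≤b b<nm = begin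
      stageColour (n * m) a b
        ≡⟨ stageColour-class-cell (n * m) a<m m≤b ⟩
      classCellColour (n * m) a b
        ≡⟨ cong (λ s → if ⌊ a ≟ column b ⌋ then black else if s then red else none)
                (absorbed-initial (m<n*o⇒m/o<n {n = n} b<nm) a<m) ⟩
      (if ⌊ a ≟ column b ⌋ then black else none)
        ≡⟨ if-black-none ⌊ a ≟ column b ⌋ ⟩
      toColour ⌊ a ≟ column b ⌋
        ≡⟨ cong (λ x → toColour ⌊ x ≟ column b ⌋) (m<n⇒m%n≡m a<m) ⟨
      toColour ⌊ column a ≟ column b ⌋
        ≡⟨ cong (λ s → toColour (s ∨ ⌊ column a ≟ column b ⌋)) (⌊⌋-false (row a ≟ row b) other-row) ⟨
      cellColour a b ∎
      where
      open ≡-Reasoning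
      other-row : row a ≢ row b
      other-row same-row = <⇒≢ (m≥n⇒m/n>0 m≤b) (trans (sym (m<n⇒m/n≡0 a<m)) same-row)

    stageColour-initial-≢ : ∀ {a b} → a ≢ b → a < n * m → b < n * m → stageColour (n * m) a b ≡ cellColour a b
    stageColour-initial-≢ {a} {b} a≢b a<nm b<nm with m ≤? a | m ≤? b
    ... | no a≱m  | no b≱m  = stageColour-initial-classes a≢b (≰⇒> a≱m) (≰⇒> b≱m)
    ... | no a≱m  | yes m≤b = stageColour-initial-class-cell (≰⇒> a≱m) m≤b b<nm
    ... | yes m≤a | no b≱m  = begin
      stageColour (n * m) a b ≡⟨ stageColour-sym (n * m) a b ⟩
      stageColour (n * m) b a ≡⟨ stageColour-initial-class-cell (≰⇒> b≱m) m≤a a<nm ⟩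
      cellColour b a          ≡⟨ cellColour-sym b a ⟩
      cellColour a b          ∎
      where open ≡-Reasoning
    ... | yes m≤a | yes m≤b = stageColour-cells (n * m) a≢b m≤a m≤b

    rookColour≡stageColour : ∀ {a b} → a < n * m → b < n * m → rookColour a b ≡ stageColour (n * m) a b
    rookColour≡stageColour {a} {b} a<nm b<nm with <-cmp a b
    ... | tri< _ a≢b _  = trans (rookColour-≢ a≢b) (sym (stageColour-initial-≢ a≢b a<nm b<nm))
    ... | tri≈ _ refl _ = trans (rookColour-refl a) (sym (stageColour-refl (n * m) a))
    ... | tri> _ a≢b _  = trans (rookColour-≢ a≢b) (sym (stageColour-initial-≢ a≢b a<nm b<nm))

    rook≐stage : rook n m ≐ stage (n * m)
    rook≐stage a b = trans (rook≐rookColour a b) (rookColour≡stageColour (toℕ<n a) (toℕ<n b))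

theorem1p6 : (n m : ℕ) → 1 ≤ n → 1 ≤ m → TwwAtMost (rook n m) (2 * (m ∸ 1))
theorem1p6 n (suc m′) 1≤n _ =
  DSequence-cong (λ a b → sym (rook≐stage a b))
    (stage-DSequence (n * m) (m≤n*m m n {{>-nonZero 1≤n}}) ≤-refl)
  where
  open Rook n m′
  open Initial 1≤n
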